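{- Suppose that $b\geqslant 9$ is an integer with $b\equiv 1\pmod 4$. There exists a signed magic array set $\mathrm{SMAS}(5,b;2c)$ for all integers $c\geqslant 4$ such that $c\equiv 0\pmod 4$.
   Context: For positive integers $a,b,e$, a signed magic array set $\mathrm{SMAS}(a,b;e)$ is a set of $e$ (completely filled) arrays of size $a\times b$ with entries in $\Omega\subset\mathbb{Z}$, where $\Omega=\{0,\pm1,\pm2,\ldots,\pm(abe-1)/2\}$ if $abe$ is odd and $\Omega=\{\pm1,\pm2,\ldots,\pm abe/2\}$ if $abe$ is even, such that (a) every $\omega\in\Omega$ appears exactly once and in a unique array; (b) for every array, the sum of the elements in each row and in each column is $0$. -}

module Defs where

open import Data.Nat as ℕ using (ℕ; suc; _*_; _/_; _%_)
open import Data.Integer as ℤ using (ℤ; ∣_∣; +_)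
import Data.Fin
open Data.Fin using (Fin)
open import Data.Product using (Σ; ∃; _×_; _,_)
open import Relation.Binary.PropositionalEquality using (_≡_; _≢_)

sumFin : (n : ℕ) → (Fin n → ℤ) → ℤ
sumFin ℕ.zero f = + 0
sumFin (suc n) f = f Data.Fin.zero ℤ.+ sumFin n (λ i → f (Data.Fin.suc i))

InΩ : ℕ → ℤ → Set
InΩ N x = (N % 2 ≡ 1 → ∣ x ∣ ℕ.≤ (N ℕ.∸ 1) / 2)
        × (N % 2 ≡ 0 → (x ≢ + 0) × (∣ x ∣ ℕ.≤ N / 2))

Arrays : ℕ → ℕ → ℕ → Set
Arrays a b e = Fin e → Fin a → Fin b → ℤ

record IsSMAS (a b e : ℕ) (A : Arrays a b e) : Set where
  field
    entries-in-Ω : ∀ k i j → InΩ (a * b * e) (A k i j)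
    injective    : ∀ k i j k′ i′ j′ → A k i j ≡ A k′ i′ j′ →
                   (k ≡ k′) × (i ≡ i′) × (j ≡ j′)
    surjective   : ∀ ω → InΩ (a * b * e) ω →
                   ∃ λ k → ∃ λ i → ∃ λ j → A k i j ≡ ω
    row-sums     : ∀ k i → sumFin b (λ j → A k i j) ≡ + 0
    col-sums     : ∀ k j → sumFin a (λ i → A k i j) ≡ + 0

SMAS : ℕ → ℕ → ℕ → Set
SMAS a b e = Σ (Arrays a b e) (IsSMAS a b e)

-- Write b = 9 + 4s and c = 4(g + 1), and put n = b + 2, T = cn and M = 5bc, so that the
-- entries must be ±1, …, ±M.  For τ < T the numbers x = 2τ + 1, y = 3T − τ, z = 3T + τ + 1
-- satisfy x + y = z.  The 2c arrays come in c pairs, and pair m uses the n triples with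
-- τ ∈ [mn, mn + n).  Rows 0–2 of an array open with a 3 × 3 Latin square of the signed
-- triples x, y, −z, followed by columns that each hold a whole triple, in pairs of opposite
-- sign.  Rows 3–4 are negatives of each other from column 3 on, where they carry the
-- remaining numbers as progressions a, a + d, a + 2d, a + 3d signed +, −, −, +; their first
-- five columns hold the elements of two more triples and two small even numbers, which balance
-- both these rows and the columns of the Latin square.  Every entry is a sign and a code; reading the
-- position back from the code gives injectivity, and as there are 2M cells for 2M values,
-- injectivity gives surjectivity.

module Submission where

open import Defs
open import Data.Nat using (ℕ; _≤_; _*_; _%_)
open import Relation.Binary.PropositionalEquality using (_≡_)

open import Data.Bool using (Bool; true; false; not; _xor_)
open import Data.Empty using (⊥; ⊥-elim)
open import Data.Fin as Fin using (Fin; toℕ; fromℕ<; remQuot; combine)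
import Data.Fin.Properties as Finₚ
open import Data.Integer as ℤ using (ℤ; +_; -[1+_]; +[1+_]; ∣_∣)
import Data.Integer.Properties as ℤₚ
import Data.Integer.Tactic.RingSolver as ℤ-Solver
open import Data.Nat as ℕ using (zero; suc; _+_; _∸_; _<_; z≤n; s≤s; NonZero)
import Data.Nat.Properties as ℕₚ
open import Data.Nat.DivMod using (_/_; [m+kn]%n≡m%n; m<n⇒m%n≡m; m≡m%n+[m/n]*n; m*n%n≡0; m*n/n≡m)
open import Data.Nat.Tactic.RingSolver using (solve-∀; solve)
open import Data.List using (_∷_; [])
open import Data.Product using (∃; _×_; _,_; proj₁; proj₂; map₁; uncurry)
open import Data.Sum as Sum using (_⊎_; inj₁; inj₂)
open import Function using (id; _∘_)
open import Function.Definitions using (Injective)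
open import Relation.Nullary using (yes; no)
open import Relation.Binary.PropositionalEquality
  using (_≢_; refl; sym; trans; cong; cong₂; subst; subst₂; module ≡-Reasoning)

open ≡-Reasoning

bit : Bool → ℕ
bit false = 0
bit true  = 1

bit≤1 : ∀ σ → bit σ ≤ 1
bit≤1 true  = ℕₚ.≤-refl
bit≤1 false = z≤n

xor-cancelʳ : ∀ σ p → (σ xor p) xor σ ≡ p
xor-cancelʳ true  true  = refl
xor-cancelʳ true  false = refl
xor-cancelʳ false true  = refl
xor-cancelʳ false false = refl

-- Division with remainder by 2, 3 and 4 by structural recursion: unlike _/_ and _%_ these
-- unfold on successors, which the block sums sumℤ-pairs and sumℤ-quadruples rely on.

halve : ℕ → ℕ × Bool
halve zero          = 0 , false
halve (suc zero)    = 0 , true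
halve (suc (suc k)) = map₁ suc (halve k)

halve-correct : ∀ k → 2 * proj₁ (halve k) + bit (proj₂ (halve k)) ≡ k
halve-correct zero          = refl
halve-correct (suc zero)    = refl
halve-correct (suc (suc k)) =
  trans (cong (_+ bit (proj₂ (halve k))) (ℕₚ.*-suc 2 (proj₁ (halve k))))
        (cong (suc ∘ suc) (halve-correct k))

halve-2*+ : ∀ q σ → halve (2 * q + bit σ) ≡ (q , σ)
halve-2*+ zero    false = refl
halve-2*+ zero    true  = refl
halve-2*+ (suc q) σ     =
  trans (cong (λ k → halve (k + bit σ)) (ℕₚ.*-suc 2 q)) (cong (map₁ suc) (halve-2*+ q σ))

halve-even : ∀ h → halve (2 * h) ≡ (h , false)
halve-even h = trans (cong halve (sym (ℕₚ.+-identityʳ (2 * h)))) (halve-2*+ h false)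

halve-odd : ∀ h → halve (suc (2 * h)) ≡ (h , true)
halve-odd h = trans (cong halve (ℕₚ.+-comm 1 (2 * h))) (halve-2*+ h true)

odd-< : ∀ {h U} → h < U → suc (2 * h) < 2 * U
odd-< {h} h<U = ℕₚ.≤-trans (ℕₚ.≤-reflexive (sym (ℕₚ.*-suc 2 h))) (ℕₚ.*-monoʳ-≤ 2 h<U)

halve-< : ∀ k D → k < 2 * D → proj₁ (halve k) < D
halve-< k D k<2D = ℕₚ.*-cancelˡ-< 2 _ _
  (ℕₚ.≤-<-trans (ℕₚ.≤-trans (ℕₚ.m≤m+n _ _) (ℕₚ.≤-reflexive (halve-correct k))) k<2D)

third : ℕ → ℕ × ℕ
third zero                = 0 , 0
third (suc zero)          = 0 , 1
third (suc (suc zero))    = 0 , 2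
third (suc (suc (suc k))) = map₁ suc (third k)

third-3*+ : ∀ q r → r < 3 → third (3 * q + r) ≡ (q , r)
third-3*+ zero zero                   _ = refl
third-3*+ zero (suc zero)             _ = refl
third-3*+ zero (suc (suc zero))       _ = refl
third-3*+ zero (suc (suc (suc r)))    (s≤s (s≤s (s≤s ())))
third-3*+ (suc q) r r<3 =
  trans (cong (λ k → third (k + r)) (ℕₚ.*-suc 3 q)) (cong (map₁ suc) (third-3*+ q r r<3))

quarter : ℕ → ℕ × ℕ
quarter zero                      = 0 , 0
quarter (suc zero)                = 0 , 1
quarter (suc (suc zero))          = 0 , 2
quarter (suc (suc (suc zero)))    = 0 , 3
quarter (suc (suc (suc (suc k)))) = map₁ suc (quarter k)

quarter-correct : ∀ k → 4 * proj₁ (quarter k) + proj₂ (quarter k) ≡ k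
quarter-correct zero                      = refl
quarter-correct (suc zero)                = refl
quarter-correct (suc (suc zero))          = refl
quarter-correct (suc (suc (suc zero)))    = refl
quarter-correct (suc (suc (suc (suc k)))) =
  trans (cong (_+ proj₂ (quarter k)) (ℕₚ.*-suc 4 (proj₁ (quarter k))))
        (cong (suc ∘ suc ∘ suc ∘ suc) (quarter-correct k))

quarter-4*+ : ∀ q r → r < 4 → quarter (4 * q + r) ≡ (q , r)
quarter-4*+ zero zero                      _ = refl
quarter-4*+ zero (suc zero)                _ = refl
quarter-4*+ zero (suc (suc zero))          _ = refl
quarter-4*+ zero (suc (suc (suc zero)))    _ = refl
quarter-4*+ zero (suc (suc (suc (suc r)))) (s≤s (s≤s (s≤s (s≤s ()))))
quarter-4*+ (suc q) r r<4 =
  trans (cong (λ k → quarter (k + r)) (ℕₚ.*-suc 4 q)) (cong (map₁ suc) (quarter-4*+ q r r<4))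

quarter-rem< : ∀ k → proj₂ (quarter k) < 4
quarter-rem< zero                      = s≤s z≤n
quarter-rem< (suc zero)                = s≤s (s≤s z≤n)
quarter-rem< (suc (suc zero))          = s≤s (s≤s (s≤s z≤n))
quarter-rem< (suc (suc (suc zero)))    = s≤s (s≤s (s≤s (s≤s z≤n)))
quarter-rem< (suc (suc (suc (suc k)))) = quarter-rem< k

quarter-< : ∀ k D → k < 4 * D → proj₁ (quarter k) < D
quarter-< k D k<4D = ℕₚ.*-cancelˡ-< 4 _ _
  (ℕₚ.≤-<-trans (ℕₚ.≤-trans (ℕₚ.m≤m+n _ _) (ℕₚ.≤-reflexive (quarter-correct k))) k<4D)

/-%-unique : ∀ d .{{_ : NonZero d}} q r → r < d → ((q * d + r) / d ≡ q) × ((q * d + r) % d ≡ r)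
/-%-unique d q r r<d = quotient , remainder
  where
  remainder : (q * d + r) % d ≡ r
  remainder = trans (cong (_% d) (ℕₚ.+-comm (q * d) r))
                    (trans ([m+kn]%n≡m%n r q d) (m<n⇒m%n≡m r<d))
  quotient : (q * d + r) / d ≡ q
  quotient = ℕₚ.*-cancelʳ-≡ _ q d (ℕₚ.+-cancelˡ-≡ r _ _ (begin
    r + (q * d + r) / d * d                 ≡⟨ cong (_+ (q * d + r) / d * d) (sym remainder) ⟩
    (q * d + r) % d + (q * d + r) / d * d   ≡⟨ sym (m≡m%n+[m/n]*n (q * d + r) d) ⟩
    q * d + r                               ≡⟨ ℕₚ.+-comm (q * d) r ⟩
    r + q * d                               ∎))

*+-< : ∀ d {q Q r} → q < Q → r < d → d * q + r < d * Q
*+-< d {q} {Q} {r} q<Q r<d = ℕₚ.<-≤-trans (ℕₚ.+-monoʳ-< (d * q) r<d)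
  (ℕₚ.≤-trans (ℕₚ.≤-reflexive (trans (ℕₚ.+-comm (d * q) d) (sym (ℕₚ.*-suc d q))))
              (ℕₚ.*-monoʳ-≤ d q<Q))

*+-<′ : ∀ d {q Q r} → q < Q → r < d → q * d + r < Q * d
*+-<′ d {q} {Q} {r} q<Q r<d = subst₂ (λ x y → x + r < y) (ℕₚ.*-comm d q) (ℕₚ.*-comm d Q) (*+-< d q<Q r<d)

<⇒∃suc+ : ∀ {a b} → a < b → ∃ λ d → b ≡ suc (a + d)
<⇒∃suc+ a<b with ℕₚ.m≤n⇒∃[o]m+o≡n a<b
... | d , eq = d , sym eq

∸-suc-involutive : ∀ U τ → τ < U → U ∸ suc (U ∸ suc τ) ≡ τ
∸-suc-involutive U τ τ<U with <⇒∃suc+ τ<U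
... | d , refl = trans (cong (τ + d ∸_) (ℕₚ.m+n∸m≡n τ d)) (ℕₚ.m+n∸n≡m τ d)

∸-suc-< : ∀ U τ → τ < U → U ∸ suc τ < U
∸-suc-< U τ τ<U with <⇒∃suc+ τ<U
... | d , refl = subst (_< suc (τ + d)) (sym (ℕₚ.m+n∸m≡n τ d)) (s≤s (ℕₚ.m≤n+m d τ))

splitAt : ℕ → ℕ → ℕ ⊎ ℕ
splitAt zero    x       = inj₂ x
splitAt (suc A) zero    = inj₁ zero
splitAt (suc A) (suc x) = Sum.map suc id (splitAt A x)

splitAt-< : ∀ {A x} → x < A → splitAt A x ≡ inj₁ x
splitAt-< {suc A} {zero}  _          = refl
splitAt-< {suc A} {suc x} (s≤s x<A) = cong (Sum.map suc id) (splitAt-< x<A)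

splitAt-+ : ∀ A y → splitAt A (A + y) ≡ inj₂ y
splitAt-+ zero    y = refl
splitAt-+ (suc A) y = cong (Sum.map suc id) (splitAt-+ A y)

splitAt-inj₁ : ∀ A x {y} → splitAt A x ≡ inj₁ y → x ≡ y × x < A
splitAt-inj₁ zero    x       ()
splitAt-inj₁ (suc A) zero    refl = refl , s≤s z≤n
splitAt-inj₁ (suc A) (suc x) eq with splitAt A x in e
... | inj₁ _ with eq
...   | refl = cong suc (proj₁ (splitAt-inj₁ A x e)) , s≤s (proj₂ (splitAt-inj₁ A x e))
splitAt-inj₁ (suc A) (suc x) () | inj₂ _

splitAt-inj₂ : ∀ A x {y} → splitAt A x ≡ inj₂ y → x ≡ A + y
splitAt-inj₂ zero    x       refl = refl
splitAt-inj₂ (suc A) zero    ()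
splitAt-inj₂ (suc A) (suc x) eq with splitAt A x in e
splitAt-inj₂ (suc A) (suc x) () | inj₁ _
... | inj₂ _ with eq
...   | refl = cong suc (splitAt-inj₂ A x e)

sumℤ : ℕ → (ℕ → ℤ) → ℤ
sumℤ zero    f = + 0
sumℤ (suc k) f = f 0 ℤ.+ sumℤ k (f ∘ suc)

sumℕ : ℕ → (ℕ → ℕ) → ℕ
sumℕ zero    f = 0
sumℕ (suc k) f = f 0 + sumℕ k (f ∘ suc)

sumFin-toℕ : ∀ k (f : ℕ → ℤ) → sumFin k (f ∘ toℕ) ≡ sumℤ k f
sumFin-toℕ zero    f = refl
sumFin-toℕ (suc k) f = cong (λ z → f 0 ℤ.+ z) (sumFin-toℕ k (f ∘ suc))

sumℤ-+ : ∀ k l f → sumℤ (k + l) f ≡ sumℤ k f ℤ.+ sumℤ l (λ j → f (k + j))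
sumℤ-+ zero    l f = sym (ℤₚ.+-identityˡ (sumℤ l f))
sumℤ-+ (suc k) l f = trans (cong (λ z → f 0 ℤ.+ z) (sumℤ-+ k l (f ∘ suc)))
                           (sym (ℤₚ.+-assoc (f 0) _ _))

sumℤ-pairs : ∀ D (v : ℕ × Bool → ℤ) → (∀ q → v (q , false) ℤ.+ v (q , true) ≡ + 0) →
             sumℤ (D * 2) (v ∘ halve) ≡ + 0
sumℤ-pairs zero    v pair-zero = refl
sumℤ-pairs (suc D) v pair-zero = trans (sym (ℤₚ.+-assoc (v (0 , false)) (v (0 , true)) _))
  (cong₂ ℤ._+_ (pair-zero 0) (sumℤ-pairs D (v ∘ map₁ suc) (pair-zero ∘ suc)))

sumℤ-quadruples : ∀ D (v : ℕ × ℕ → ℤ) → (∀ q → sumℤ 4 (λ r → v (q , r)) ≡ + 0) →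
                  sumℤ (D * 4) (v ∘ quarter) ≡ + 0
sumℤ-quadruples zero    v quad-zero = refl
sumℤ-quadruples (suc D) v quad-zero = trans (sumℤ-+ 4 (D * 4) (v ∘ quarter))
  (cong₂ ℤ._+_ (quad-zero 0) (sumℤ-quadruples D (v ∘ map₁ suc) (quad-zero ∘ suc)))

_⁺ : ℤ → ℕ
(+ k)    ⁺ = k
-[1+ k ] ⁺ = 0

_⁻ : ℤ → ℕ
(+ k)    ⁻ = 0
-[1+ k ] ⁻ = suc k

⁺-⁻ : ∀ i → + (i ⁺) ℤ.- + (i ⁻) ≡ i
⁺-⁻ (+ k)    = cong +_ (ℕₚ.+-identityʳ k)
⁺-⁻ -[1+ k ] = refl

sumℤ-⁺-⁻ : ∀ k f → sumℤ k f ≡ + sumℕ k (_⁺ ∘ f) ℤ.- + sumℕ k (_⁻ ∘ f)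
sumℤ-⁺-⁻ zero    f = refl
sumℤ-⁺-⁻ (suc k) f = begin
  f 0 ℤ.+ sumℤ k (f ∘ suc)
    ≡⟨ cong₂ ℤ._+_ (sym (⁺-⁻ (f 0))) (sumℤ-⁺-⁻ k (f ∘ suc)) ⟩
  (+ a ℤ.- + b) ℤ.+ (+ A ℤ.- + B)
    ≡⟨ interchange (+ a) (+ b) (+ A) (+ B) ⟩
  (+ a ℤ.+ + A) ℤ.- (+ b ℤ.+ + B)
    ≡⟨ sym (cong₂ ℤ._-_ (ℤₚ.pos-+ a A) (ℤₚ.pos-+ b B)) ⟩
  + (a + A) ℤ.- + (b + B) ∎
  where
  a = f 0 ⁺
  b = f 0 ⁻
  A = sumℕ k (_⁺ ∘ f ∘ suc)
  B = sumℕ k (_⁻ ∘ f ∘ suc)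
  interchange : ∀ w x y z → (w ℤ.- x) ℤ.+ (y ℤ.- z) ≡ (w ℤ.+ y) ℤ.- (x ℤ.+ z)
  interchange = ℤ-Solver.solve-∀

-- In a line of the construction the signs are known, so both parts compute and every
-- line sum reduces to an identity between magnitudes in ℕ.
sumℤ-balanced : ∀ k f → sumℕ k (_⁺ ∘ f) ≡ sumℕ k (_⁻ ∘ f) → sumℤ k f ≡ + 0
sumℤ-balanced k f balance = begin
  sumℤ k f                  ≡⟨ sumℤ-⁺-⁻ k f ⟩
  + N⁺ ℤ.- + sumℕ k (_⁻ ∘ f) ≡⟨ cong (λ N → + N⁺ ℤ.- + N) (sym balance) ⟩
  + N⁺ ℤ.- + N⁺             ≡⟨ ℤₚ.+-inverseʳ (+ N⁺) ⟩
  + 0                       ∎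
  where N⁺ = sumℕ k (_⁺ ∘ f)

injective⇒surjective : ∀ {n} (f : Fin n → Fin n) → Injective _≡_ _≡_ f → ∀ y → ∃ λ x → f x ≡ y
injective⇒surjective {zero}  f f-inj ()
injective⇒surjective {suc n} f f-inj y with Finₚ.any? (λ x → f x Fin.≟ y)
... | yes hit = hit
... | no miss = ⊥-elim collision
  where
  avoids : ∀ x → y ≢ f x
  avoids x eq = miss (x , sym eq)
  squeeze : Fin (suc n) → Fin n
  squeeze x = Fin.punchOut (avoids x)
  collision : ⊥
  collision with Finₚ.pigeonhole (ℕₚ.n<1+n n) squeeze
  ... | i , j , i<j , same = ℕₚ.<⇒≢ i<j
    (cong toℕ (f-inj (Finₚ.punchOut-injective (avoids i) (avoids j) same)))

NonzeroWithin : ℕ → ℤ → Set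
NonzeroWithin M ω = (ω ≢ + 0) × (∣ ω ∣ ≤ M)

signedRank : ℕ → ℤ → ℕ
signedRank M (+ zero)  = 0
signedRank M +[1+ k ] = k
signedRank M -[1+ k ] = M + k

signedRank-< : ∀ M ω → NonzeroWithin M ω → signedRank M ω < M + M
signedRank-< M (+ zero)  (nonzero , _) = ⊥-elim (nonzero refl)
signedRank-< M +[1+ k ] (_ , k<M)     = ℕₚ.<-≤-trans k<M (ℕₚ.m≤m+n M M)
signedRank-< M -[1+ k ] (_ , k<M)     = ℕₚ.+-monoʳ-< M k<M

signedRank-injective : ∀ M ω ω′ → NonzeroWithin M ω → NonzeroWithin M ω′ →
                       signedRank M ω ≡ signedRank M ω′ → ω ≡ ω′
signedRank-injective M (+ zero)  _          (nonzero , _) _ _ = ⊥-elim (nonzero refl)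
signedRank-injective M +[1+ k ] (+ zero)   _ (nonzero , _) _ = ⊥-elim (nonzero refl)
signedRank-injective M -[1+ k ] (+ zero)   _ (nonzero , _) _ = ⊥-elim (nonzero refl)
signedRank-injective M +[1+ k ] +[1+ k′ ] _ _ refl = refl
signedRank-injective M -[1+ k ] -[1+ k′ ] _ _ eq   = cong -[1+_] (ℕₚ.+-cancelˡ-≡ M k k′ eq)
signedRank-injective M +[1+ k ] -[1+ k′ ] (_ , k<M) _ eq =
  ⊥-elim (ℕₚ.<⇒≱ k<M (ℕₚ.≤-trans (ℕₚ.m≤m+n M k′) (ℕₚ.≤-reflexive (sym eq))))
signedRank-injective M -[1+ k ] +[1+ k′ ] _ (_ , k′<M) eq =
  ⊥-elim (ℕₚ.<⇒≱ k′<M (ℕₚ.≤-trans (ℕₚ.m≤m+n M k) (ℕₚ.≤-reflexive eq)))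

signedIndex : ∀ M ω → NonzeroWithin M ω → Fin (M + M)
signedIndex M ω bounded = fromℕ< (signedRank-< M ω bounded)

signedIndex-injective : ∀ M ω ω′ (b : NonzeroWithin M ω) (b′ : NonzeroWithin M ω′) →
                        signedIndex M ω b ≡ signedIndex M ω′ b′ → ω ≡ ω′
signedIndex-injective M ω ω′ b b′ eq = signedRank-injective M ω ω′ b b′ (begin
  signedRank M ω              ≡⟨ sym (Finₚ.toℕ-fromℕ< (signedRank-< M ω b)) ⟩
  toℕ (signedIndex M ω b)     ≡⟨ cong toℕ eq ⟩
  toℕ (signedIndex M ω′ b′)   ≡⟨ Finₚ.toℕ-fromℕ< (signedRank-< M ω′ b′) ⟩
  signedRank M ω′             ∎)

ArrayCell : ℕ → ℕ → ℕ → Set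
ArrayCell e a b = Fin e × Fin a × Fin b

unflatten : ∀ e a b → Fin (e * (a * b)) → ArrayCell e a b
unflatten e a b x with remQuot {e} (a * b) x
... | k , y = k , remQuot {a} b y

remQuot-injective : ∀ {m} k {x y : Fin (m * k)} → remQuot {m} k x ≡ remQuot k y → x ≡ y
remQuot-injective {m} k {x} {y} eq = begin
  x                                    ≡⟨ sym (Finₚ.combine-remQuot {m} k x) ⟩
  uncurry combine (remQuot {m} k x)    ≡⟨ cong (uncurry combine) eq ⟩
  uncurry combine (remQuot {m} k y)    ≡⟨ Finₚ.combine-remQuot {m} k y ⟩
  y                                    ∎

unflatten-injective : ∀ e a b → Injective _≡_ _≡_ (unflatten e a b)
unflatten-injective e a b eq = remQuot-injective {e} (a * b)
  (cong₂ _,_ (cong proj₁ eq) (remQuot-injective {a} b (cong proj₂ eq)))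

-- There are as many cells as admissible values, so injectivity is enough.
arrays-surjective : ∀ a b e M → M + M ≡ e * (a * b) → (A : Arrays a b e) →
  (∀ k i j → NonzeroWithin M (A k i j)) →
  (∀ k i j k′ i′ j′ → A k i j ≡ A k′ i′ j′ → (k ≡ k′) × (i ≡ i′) × (j ≡ j′)) →
  ∀ ω → NonzeroWithin M ω → ∃ λ k → ∃ λ i → ∃ λ j → A k i j ≡ ω
arrays-surjective a b e M cells A within injective ω ω-within =
  proj₁ t , proj₁ (proj₂ t) , proj₂ (proj₂ t) ,
  signedIndex-injective M (at t) ω (at-within t) ω-within (proj₂ found)
  where
  cellAt : Fin (M + M) → ArrayCell e a b
  cellAt = unflatten e a b ∘ Fin.cast cells

  cellAt-injective : Injective _≡_ _≡_ cellAt
  cellAt-injective {x} {y} eq = Finₚ.toℕ-injective (begin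
    toℕ x                  ≡⟨ sym (Finₚ.toℕ-cast cells x) ⟩
    toℕ (Fin.cast cells x) ≡⟨ cong toℕ (unflatten-injective e a b eq) ⟩
    toℕ (Fin.cast cells y) ≡⟨ Finₚ.toℕ-cast cells y ⟩
    toℕ y                  ∎)

  at : ArrayCell e a b → ℤ
  at (k , i , j) = A k i j

  at-within : ∀ t → NonzeroWithin M (at t)
  at-within (k , i , j) = within k i j

  at-injective : Injective _≡_ _≡_ at
  at-injective {k , i , j} {k′ , i′ , j′} eq with injective k i j k′ i′ j′ eq
  ... | refl , refl , refl = refl

  relabel : Fin (M + M) → Fin (M + M)
  relabel x = signedIndex M (at (cellAt x)) (at-within (cellAt x))

  relabel-injective : Injective _≡_ _≡_ relabel
  relabel-injective {x} {y} eq = cellAt-injective (at-injective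
    (signedIndex-injective M (at (cellAt x)) (at (cellAt y)) (at-within (cellAt x)) (at-within (cellAt y)) eq))

  found = injective⇒surjective relabel relabel-injective (signedIndex M ω ω-within)
  t = cellAt (proj₁ found)

injective-within⇒SMAS : ∀ a b e M → a * b * e ≡ M * 2 → (A : Arrays a b e) →
  (∀ k i j → NonzeroWithin M (A k i j)) →
  (∀ k i j k′ i′ j′ → A k i j ≡ A k′ i′ j′ → (k ≡ k′) × (i ≡ i′) × (j ≡ j′)) →
  (∀ k i → sumFin b (λ j → A k i j) ≡ + 0) →
  (∀ k j → sumFin a (λ i → A k i j) ≡ + 0) →
  SMAS a b e
injective-within⇒SMAS a b e M size A within injective rows cols = A , record
  { entries-in-Ω = in-Ω
  ; injective    = injective
  ; surjective   = λ ω ω∈Ω → arrays-surjective a b e M cells A within injective ω (Ω-within ω ω∈Ω)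
  ; row-sums     = rows
  ; col-sums     = cols
  }
  where
  N = a * b * e

  even : N % 2 ≡ 0
  even = trans (cong (_% 2) size) (m*n%n≡0 M 2)

  half : N / 2 ≡ M
  half = trans (cong (_/ 2) size) (m*n/n≡m M 2)

  in-Ω : ∀ k i j → InΩ N (A k i j)
  in-Ω k i j = (λ odd → ⊥-elim (0≢1 (trans (sym even) odd))) ,
               (λ _ → proj₁ (within k i j) , subst (∣ A k i j ∣ ≤_) (sym half) (proj₂ (within k i j)))
    where 0≢1 : 0 ≢ 1
          0≢1 ()

  Ω-within : ∀ ω → InΩ N ω → NonzeroWithin M ω
  Ω-within ω ω∈Ω = proj₁ (proj₂ ω∈Ω even) , subst (∣ ω ∣ ≤_) half (proj₂ (proj₂ ω∈Ω even))

  cells : M + M ≡ e * (a * b)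
  cells = begin
    M + M       ≡⟨ solve (M ∷ []) ⟩
    M * 2       ≡⟨ sym size ⟩
    a * b * e   ≡⟨ ℕₚ.*-comm (a * b) e ⟩
    e * (a * b) ∎

-- Magnitudes of the entries, U standing for T.  The balance identities below are stated in
-- exactly the shape (trailing + 0 and offsets B + 0 included) in which the lines of the
-- construction compute; the truncated subtraction in yMag disappears on writing U = suc (b + d).

xMag : ℕ → ℕ
xMag a = suc (2 * a)

yMag : ℕ → ℕ → ℕ
yMag U b = suc (2 * U + (U ∸ suc b))

zMag : ℕ → ℕ → ℕ
zMag U c = suc (2 * U + (U + c))

wMag : ℕ → ℕ → ℕ
wMag w e = suc (suc (2 * (3 * w + e)))

triple-balance : ∀ U τ → τ < U → xMag τ + (yMag U τ + 0) ≡ zMag U τ + 0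
triple-balance U τ τ<U with <⇒∃suc+ τ<U
... | d , refl rewrite ℕₚ.m+n∸m≡n τ d = solve (τ ∷ d ∷ [])

triple-balance′ : ∀ U τ → τ < U → yMag U τ + (xMag τ + 0) ≡ zMag U τ + 0
triple-balance′ U τ τ<U with <⇒∃suc+ τ<U
... | d , refl rewrite ℕₚ.m+n∸m≡n τ d = solve (τ ∷ d ∷ [])

coreColumn₀-balance : ∀ U B w → B + 4 < U →
  xMag (B + 2) + (yMag U (B + 4) + (w + 0)) ≡ zMag U (B + 0) + (w + 0)
coreColumn₀-balance U B w lt with <⇒∃suc+ lt
... | d , refl rewrite ℕₚ.m+n∸m≡n (B + 4) d = solve (B ∷ d ∷ w ∷ [])

coreColumn₁-balance : ∀ U B v → B + 2 < U →
  xMag (B + 0) + (yMag U (B + 2) + (wMag (v + 1) 0 + 0)) ≡ zMag U (B + 4) + (wMag (v + 0) 0 + 0)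
coreColumn₁-balance U B v lt with <⇒∃suc+ lt
... | d , refl rewrite ℕₚ.m+n∸m≡n (B + 2) d = solve (B ∷ d ∷ v ∷ [])

coreColumn₂-balance : ∀ U B v → B + 0 < U →
  yMag U (B + 0) + (xMag (B + 4) + (wMag (v + 0) 1 + 0)) ≡ zMag U (B + 2) + (wMag (v + 1) 1 + 0)
coreColumn₂-balance U B v lt with <⇒∃suc+ lt
... | d , refl rewrite ℕₚ.m+n∸m≡n (B + 0) d = solve (B ∷ d ∷ v ∷ [])

lowerLeft-balance : ∀ U B v → B + 1 < U →
  xMag (B + 3) + (wMag v 0 + (yMag U (B + 1) + 0)) ≡ wMag v 1 + (zMag U (B + 3) + 0)
lowerLeft-balance U B v lt with <⇒∃suc+ lt
... | d , refl rewrite ℕₚ.m+n∸m≡n (B + 1) d = solve (B ∷ d ∷ v ∷ [])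

lowerLeft-balance′ : ∀ U B v → B + 3 < U →
  xMag (B + 1) + (wMag v 1 + (yMag U (B + 3) + 0)) ≡ wMag v 0 + (zMag U (B + 1) + 0)
lowerLeft-balance′ U B v lt with <⇒∃suc+ lt
... | d , refl rewrite ℕₚ.m+n∸m≡n (B + 3) d = solve (B ∷ d ∷ v ∷ [])

Progression : (ℕ → ℕ) → Set
Progression f = ∃ λ a → ∃ λ d → ∀ k → f k ≡ a + d * k

progression-balance : ∀ f → Progression f → suc (f 0) + (suc (f 3) + 0) ≡ suc (f 1) + (suc (f 2) + 0)
progression-balance f (a , d , f≡) rewrite f≡ 0 | f≡ 1 | f≡ 2 | f≡ 3 = solve (a ∷ d ∷ [])

module Construction (s g : ℕ) where

  b c n T P Q M nW nE nL : ℕ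
  b  = 9 + 4 * s
  c  = 4 * suc g
  n  = 11 + 4 * s
  T  = c * n
  P  = 3 + 2 * s
  Q  = suc s
  M  = 5 * b * c
  nW = 2 * suc g
  nE = suc g * (5 + 4 * s)
  nL = suc g * (1 + 4 * s)

  T-split : T ≡ 6 * c + 4 * nE
  T-split = identity s g
    where identity : ∀ s g → 4 * suc g * (11 + 4 * s) ≡ 6 * (4 * suc g) + 4 * (suc g * (5 + 4 * s))
          identity = solve-∀

  M-split : 2 * T + (T + (T + 4 * nL)) ≡ M
  M-split = identity s g
    where identity : ∀ s g → let T = 4 * suc g * (11 + 4 * s) in
                     2 * T + (T + (T + 4 * (suc g * (1 + 4 * s)))) ≡ 5 * (9 + 4 * s) * (4 * suc g)
          identity = solve-∀

  quadruples-split : nW + (nE + nL) ≡ 2 * c * Q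
  quadruples-split = identity s g
    where identity : ∀ s g → 2 * suc g + (suc g * (5 + 4 * s) + suc g * (1 + 4 * s)) ≡ 2 * (4 * suc g) * suc s
          identity = solve-∀

  W-quadruples : 4 * nW ≡ 2 * c
  W-quadruples = identity g
    where identity : ∀ g → 4 * (2 * suc g) ≡ 2 * (4 * suc g)
          identity = solve-∀

  -- The magnitudes rank k + 1 of X τ are the odd numbers up to 2T, those of W w e (w < 2c,
  -- e < 3) and E h the even ones, split at 12c, and Y, Z, L fill (2T, 3T], (3T, 4T], (4T, M].
  data Code : Set where
    X Y Z : ℕ → Code
    W     : ℕ → ℕ → Code
    E L   : ℕ → Code

  rank : Code → ℕ
  rank (X τ)   = 2 * τ
  rank (W w e) = suc (2 * (3 * w + e))
  rank (E h)   = suc (2 * (6 * c + h))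
  rank (Y y)   = 2 * T + y
  rank (Z τ)   = 2 * T + (T + τ)
  rank (L h)   = 2 * T + (T + (T + h))

  Valid : Code → Set
  Valid (X τ)   = τ < T
  Valid (Y y)   = y < T
  Valid (Z τ)   = τ < T
  Valid (W w e) = w < 2 * c × e < 3
  Valid (E h)   = h < 4 * nE
  Valid (L h)   = h < 4 * nL

  value : Bool × Code → ℤ
  value (true  , k) = + suc (rank k)
  value (false , k) = -[1+ rank k ]

  decode≥3T : ℕ ⊎ ℕ → Code
  decode≥3T (inj₁ τ) = Z τ
  decode≥3T (inj₂ h) = L h

  decode≥2T : ℕ ⊎ ℕ → Code
  decode≥2T (inj₁ y) = Y y
  decode≥2T (inj₂ r) = decode≥3T (splitAt T r)

  decodeOdd : ℕ ⊎ ℕ → Code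
  decodeOdd (inj₁ h) = W (proj₁ (third h)) (proj₂ (third h))
  decodeOdd (inj₂ h) = E h

  decode<2T : ℕ × Bool → Code
  decode<2T (τ , false) = X τ
  decode<2T (h , true)  = decodeOdd (splitAt (6 * c) h)

  decodeSplit : ℕ ⊎ ℕ → Code
  decodeSplit (inj₁ r) = decode<2T (halve r)
  decodeSplit (inj₂ r) = decode≥2T (splitAt T r)

  decode : ℕ → Code
  decode r = decodeSplit (splitAt (2 * T) r)

  6c≤T : 6 * c ≤ T
  6c≤T = subst (6 * c ≤_) (sym T-split) (ℕₚ.m≤m+n (6 * c) (4 * nE))

  W-index-< : ∀ w e → w < 2 * c → e < 3 → 3 * w + e < 6 * c
  W-index-< w e w<2c e<3 = ℕₚ.≤-trans (*+-< 3 w<2c e<3) (ℕₚ.≤-reflexive (sym (ℕₚ.*-assoc 3 2 c)))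

  E-index-< : ∀ h → h < 4 * nE → 6 * c + h < T
  E-index-< h h< = subst (6 * c + h <_) (sym T-split) (ℕₚ.+-monoʳ-< (6 * c) h<)

  decode-rank : ∀ k → Valid k → decode (rank k) ≡ k
  decode-rank (X τ) τ<T = begin
    decodeSplit (splitAt (2 * T) (2 * τ)) ≡⟨ cong decodeSplit (splitAt-< (ℕₚ.*-monoʳ-< 2 τ<T)) ⟩
    decode<2T (halve (2 * τ))             ≡⟨ cong decode<2T (halve-even τ) ⟩
    X τ                                   ∎
  decode-rank (W w e) (w<2c , e<3) = begin
    decodeSplit (splitAt (2 * T) (suc (2 * h)))
      ≡⟨ cong decodeSplit (splitAt-< (odd-< (ℕₚ.<-≤-trans h<6c 6c≤T))) ⟩
    decode<2T (halve (suc (2 * h)))       ≡⟨ cong decode<2T (halve-odd h) ⟩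
    decodeOdd (splitAt (6 * c) h)         ≡⟨ cong decodeOdd (splitAt-< h<6c) ⟩
    W (proj₁ (third h)) (proj₂ (third h)) ≡⟨ cong (λ qr → W (proj₁ qr) (proj₂ qr)) (third-3*+ w e e<3) ⟩
    W w e                                 ∎
    where h = 3 * w + e
          h<6c = W-index-< w e w<2c e<3
  decode-rank (E h) h< = begin
    decodeSplit (splitAt (2 * T) (suc (2 * (6 * c + h))))
      ≡⟨ cong decodeSplit (splitAt-< (odd-< (E-index-< h h<))) ⟩
    decode<2T (halve (suc (2 * (6 * c + h)))) ≡⟨ cong decode<2T (halve-odd (6 * c + h)) ⟩
    decodeOdd (splitAt (6 * c) (6 * c + h))   ≡⟨ cong decodeOdd (splitAt-+ (6 * c) h) ⟩
    E h                                       ∎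
  decode-rank (Y y) y<T = begin
    decodeSplit (splitAt (2 * T) (2 * T + y)) ≡⟨ cong decodeSplit (splitAt-+ (2 * T) y) ⟩
    decode≥2T (splitAt T y)                   ≡⟨ cong decode≥2T (splitAt-< y<T) ⟩
    Y y                                       ∎
  decode-rank (Z τ) τ<T = begin
    decodeSplit (splitAt (2 * T) (2 * T + (T + τ))) ≡⟨ cong decodeSplit (splitAt-+ (2 * T) (T + τ)) ⟩
    decode≥2T (splitAt T (T + τ))                   ≡⟨ cong decode≥2T (splitAt-+ T τ) ⟩
    decode≥3T (splitAt T τ)                         ≡⟨ cong decode≥3T (splitAt-< τ<T) ⟩
    Z τ                                             ∎
  decode-rank (L h) _ = begin
    decodeSplit (splitAt (2 * T) (2 * T + (T + (T + h)))) ≡⟨ cong decodeSplit (splitAt-+ (2 * T) _) ⟩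
    decode≥2T (splitAt T (T + (T + h)))                   ≡⟨ cong decode≥2T (splitAt-+ T (T + h)) ⟩
    decode≥3T (splitAt T (T + h))                         ≡⟨ cong decode≥3T (splitAt-+ T h) ⟩
    L h                                                   ∎

  rank-injective : ∀ k k′ → Valid k → Valid k′ → rank k ≡ rank k′ → k ≡ k′
  rank-injective k k′ valid valid′ eq =
    trans (sym (decode-rank k valid)) (trans (cong decode eq) (decode-rank k′ valid′))

  <4T⇒<M : ∀ {r} → r < 2 * T + (T + T) → r < M
  <4T⇒<M r< = ℕₚ.<-≤-trans r< (ℕₚ.≤-trans
    (ℕₚ.+-monoʳ-≤ (2 * T) (ℕₚ.+-monoʳ-≤ T (ℕₚ.m≤m+n T (4 * nL)))) (ℕₚ.≤-reflexive M-split))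

  <2T⇒<M : ∀ {r} → r < 2 * T → r < M
  <2T⇒<M r< = <4T⇒<M (ℕₚ.<-≤-trans r< (ℕₚ.m≤m+n (2 * T) _))

  rank-< : ∀ k → Valid k → rank k < M
  rank-< (X τ)   τ<T          = <2T⇒<M (ℕₚ.*-monoʳ-< 2 τ<T)
  rank-< (W w e) (w<2c , e<3) = <2T⇒<M (odd-< (ℕₚ.<-≤-trans (W-index-< w e w<2c e<3) 6c≤T))
  rank-< (E h)   h<           = <2T⇒<M (odd-< (E-index-< h h<))
  rank-< (Y y)   y<T          = <4T⇒<M (ℕₚ.+-monoʳ-< (2 * T) (ℕₚ.<-≤-trans y<T (ℕₚ.m≤m+n T T)))
  rank-< (Z τ)   τ<T          = <4T⇒<M (ℕₚ.+-monoʳ-< (2 * T) (ℕₚ.+-monoʳ-< T τ<T))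
  rank-< (L h)   h<           = subst (rank (L h) <_) M-split
    (ℕₚ.+-monoʳ-< (2 * T) (ℕₚ.+-monoʳ-< T (ℕₚ.+-monoʳ-< T h<)))

  -- Layout of the arrays

  tripleCode : ℕ → ℕ → Code
  tripleCode τ 0 = X τ
  tripleCode τ 1 = Y (T ∸ suc τ)
  tripleCode τ _ = Z τ

  tripleSign : ℕ → Bool
  tripleSign 2 = false
  tripleSign _ = true

  -- Cell (i, j) of the Latin square holds element latin i j (0, 1, 2 for x, y, z) of the
  -- triple mn + 2i.
  latin : ℕ → ℕ → ℕ
  latin 0 0 = 2
  latin 0 1 = 0
  latin 0 _ = 1
  latin 1 j = j
  latin _ 0 = 1
  latin _ 1 = 2
  latin _ _ = 0

  latinColumn : ℕ → ℕ → ℕ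
  latinColumn 0 2 = 0
  latinColumn 0 0 = 1
  latinColumn 0 _ = 2
  latinColumn 1 e = e
  latinColumn _ 1 = 0
  latinColumn _ 2 = 1
  latinColumn _ _ = 2

  -- The triples mn + 1 and mn + 3 are shared between the two arrays of pair m, in rows 3–4.
  sideOffset : Bool → ℕ → ℕ
  sideOffset false 1 = 1
  sideOffset false _ = 3
  sideOffset true  1 = 3
  sideOffset true  _ = 1

  quadSign : ℕ → Bool
  quadSign 0 = true
  quadSign 1 = false
  quadSign 2 = false
  quadSign _ = true

  quadCode₂ : ℕ ⊎ ℕ → ℕ → Code
  quadCode₂ (inj₁ ρ) k = E (4 * ρ + k)
  quadCode₂ (inj₂ ρ) k = L (4 * ρ + k)

  quadCode₁ : ℕ ⊎ ℕ → ℕ → Code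
  quadCode₁ (inj₁ ρ) k = W (4 * ρ + k) 2
  quadCode₁ (inj₂ ρ) k = quadCode₂ (splitAt nE ρ) k

  quadCode : ℕ → ℕ → Code
  quadCode ρ k = quadCode₁ (splitAt nW ρ) k

  coreCell : ℕ → Bool → ℕ → ℕ → Bool × Code
  coreCell m p i j = tripleSign (latin i j) xor p , tripleCode (m * n + 2 * i) (latin i j)

  pairCell : ℕ → Bool → ℕ → ℕ × Bool → Bool × Code
  pairCell m p i (u , σ) = tripleSign i xor σ , tripleCode (m * n + (5 + (bit p * P + u))) i

  upperCell : ℕ → Bool → ℕ → ℕ → Bool × Code
  upperCell m p i 0                   = coreCell m p i 0
  upperCell m p i 1                   = coreCell m p i 1
  upperCell m p i 2                   = coreCell m p i 2
  upperCell m p i (suc (suc (suc j))) = pairCell m p i (halve j)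

  quadCell : ℕ → Bool → Bool → ℕ × ℕ → Bool × Code
  quadCell m p r (u , k) = not r xor quadSign k , quadCode ((2 * m + bit p) * Q + u) k

  lowerCell : ℕ → Bool → Bool → ℕ → Bool × Code
  lowerCell m p r 0 = r , tripleCode (m * n + sideOffset p 0) 0
  lowerCell m p r 1 = r xor p , W (2 * m + bit r) 0
  lowerCell m p r 2 = not r xor p , W (2 * m + bit r) 1
  lowerCell m p r 3 = r , tripleCode (m * n + sideOffset p 1) 1
  lowerCell m p r 4 = not r , tripleCode (m * n + sideOffset p 2) 2
  lowerCell m p r (suc (suc (suc (suc (suc j))))) = quadCell m p r (quarter j)

  cell : ℕ → Bool → ℕ → ℕ → Bool × Code
  cell m p 0 j = upperCell m p 0 j
  cell m p 1 j = upperCell m p 1 j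
  cell m p 2 j = upperCell m p 2 j
  cell m p 3 j = lowerCell m p true j
  cell m p 4 j = lowerCell m p false j
  cell m p (suc (suc (suc (suc (suc _))))) j = true , X 0   -- there are only five rows

  -- Reading back the position of an entry

  Position : Set
  Position = ℕ × Bool × ℕ × ℕ

  fromBit : ℕ → Bool
  fromBit 0 = false
  fromBit _ = true

  fromBit-bit : ∀ p → fromBit (bit p) ≡ p
  fromBit-bit true  = refl
  fromBit-bit false = refl

  lowerRow : Bool → ℕ
  lowerRow true  = 3
  lowerRow false = 4

  sideArray : Bool → ℕ → Bool
  sideArray o 1 = o
  sideArray o _ = not o

  sideColumn : ℕ → ℕ
  sideColumn 0 = 0
  sideColumn 1 = 3
  sideColumn _ = 4

  triplePosition : Bool → ℕ → ℕ → ℕ → Position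
  triplePosition σ e m 0 = m , σ xor tripleSign e , 0 , latinColumn 0 e
  triplePosition σ e m 1 = m , sideArray false e , lowerRow (not (σ xor tripleSign e)) , sideColumn e
  triplePosition σ e m 2 = m , σ xor tripleSign e , 1 , latinColumn 1 e
  triplePosition σ e m 3 = m , sideArray true e , lowerRow (not (σ xor tripleSign e)) , sideColumn e
  triplePosition σ e m 4 = m , σ xor tripleSign e , 2 , latinColumn 2 e
  triplePosition σ e m (suc (suc (suc (suc (suc o))))) =
    m , fromBit (o / P) , e , 3 + (2 * (o % P) + bit (σ xor tripleSign e))

  wPosition : Bool → ℕ × Bool → ℕ → Position
  wPosition σ (m , r) 0 = m , σ xor r , lowerRow r , 1
  wPosition σ (m , r) _ = m , σ xor not r , lowerRow r , 2

  quadPosition : Bool → ℕ → ℕ → Position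
  quadPosition σ ρ k =
    proj₁ (halve (ρ / Q)) , proj₂ (halve (ρ / Q)) , lowerRow (not (σ xor quadSign k)) , 5 + (4 * (ρ % Q) + k)

  locate : Bool × Code → Position
  locate (σ , X τ)               = triplePosition σ 0 (τ / n) (τ % n)
  locate (σ , Y y)               = triplePosition σ 1 ((T ∸ suc y) / n) ((T ∸ suc y) % n)
  locate (σ , Z τ)               = triplePosition σ 2 (τ / n) (τ % n)
  locate (σ , W w 0)             = wPosition σ (halve w) 0
  locate (σ , W w 1)             = wPosition σ (halve w) 1
  locate (σ , W w (suc (suc _))) = quadPosition σ (proj₁ (quarter w)) (proj₂ (quarter w))
  locate (σ , E h)               = quadPosition σ (nW + proj₁ (quarter h)) (proj₂ (quarter h))
  locate (σ , L h)               = quadPosition σ (nW + (nE + proj₁ (quarter h))) (proj₂ (quarter h))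

  <11⇒<n : ∀ {o} → o < 11 → o < n
  <11⇒<n o<11 = ℕₚ.<-≤-trans o<11 (ℕₚ.m≤m+n 11 (4 * s))

  triple-< : ∀ {m o} → m < c → o < n → m * n + o < T
  triple-< {m} m<c o<n = ℕₚ.≤-trans (ℕₚ.+-monoʳ-< (m * n) o<n)
    (ℕₚ.≤-trans (ℕₚ.≤-reflexive (ℕₚ.+-comm (m * n) n)) (ℕₚ.*-monoˡ-≤ n m<c))

  locate-triple : ∀ σ e m o → e < 3 → m < c → o < n →
                  locate (σ , tripleCode (m * n + o) e) ≡ triplePosition σ e m o
  locate-triple σ e m o e<3 m<c o<n = begin
    locate (σ , tripleCode τ e)       ≡⟨ by-element e e<3 ⟩
    triplePosition σ e (τ / n) (τ % n) ≡⟨ cong₂ (triplePosition σ e) (proj₁ unique) (proj₂ unique) ⟩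
    triplePosition σ e m o             ∎
    where
    τ = m * n + o
    unique = /-%-unique n m o o<n
    by-element : ∀ e → e < 3 → locate (σ , tripleCode τ e) ≡ triplePosition σ e (τ / n) (τ % n)
    by-element 0 _ = refl
    by-element 1 _ = cong (λ y → triplePosition σ 1 (y / n) (y % n)) (∸-suc-involutive T τ (triple-< m<c o<n))
    by-element 2 _ = refl
    by-element (suc (suc (suc _))) (s≤s (s≤s (s≤s ())))

  latin-< : ∀ i j → j < 3 → latin i j < 3
  latin-< 0 0             _   = s≤s (s≤s (s≤s z≤n))
  latin-< 0 1             _   = s≤s z≤n
  latin-< 0 (suc (suc _)) _   = s≤s (s≤s z≤n)
  latin-< 1 j             j<3 = j<3
  latin-< (suc (suc i)) 0             _ = s≤s (s≤s z≤n)
  latin-< (suc (suc i)) 1             _ = s≤s (s≤s (s≤s z≤n))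
  latin-< (suc (suc i)) (suc (suc _)) _ = s≤s z≤n

  latinColumn-latin : ∀ i j → i < 3 → j < 3 → latinColumn i (latin i j) ≡ j
  latinColumn-latin 0 0 _ _ = refl
  latinColumn-latin 0 1 _ _ = refl
  latinColumn-latin 0 2 _ _ = refl
  latinColumn-latin 1 0 _ _ = refl
  latinColumn-latin 1 1 _ _ = refl
  latinColumn-latin 1 2 _ _ = refl
  latinColumn-latin 2 0 _ _ = refl
  latinColumn-latin 2 1 _ _ = refl
  latinColumn-latin 2 2 _ _ = refl
  latinColumn-latin (suc (suc (suc _))) _ (s≤s (s≤s (s≤s ()))) _
  latinColumn-latin _ (suc (suc (suc _))) _ (s≤s (s≤s (s≤s ())))

  triplePosition-core : ∀ σ e m i → i < 3 →
                        triplePosition σ e m (2 * i) ≡ (m , σ xor tripleSign e , i , latinColumn i e)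
  triplePosition-core σ e m 0 _ = refl
  triplePosition-core σ e m 1 _ = refl
  triplePosition-core σ e m 2 _ = refl
  triplePosition-core σ e m (suc (suc (suc _))) (s≤s (s≤s (s≤s ())))

  2*i<n : ∀ {i} → i < 3 → 2 * i < n
  2*i<n i<3 = <11⇒<n (ℕₚ.≤-trans (ℕₚ.*-monoʳ-< 2 i<3) (ℕₚ.+-monoʳ-≤ 6 z≤n))

  locate-coreCell : ∀ m p i j → m < c → i < 3 → j < 3 → locate (coreCell m p i j) ≡ (m , p , i , j)
  locate-coreCell m p i j m<c i<3 j<3 = begin
    locate (σ , tripleCode (m * n + 2 * i) e)    ≡⟨ locate-triple σ e m (2 * i) (latin-< i j j<3) m<c (2*i<n i<3) ⟩
    triplePosition σ e m (2 * i)                 ≡⟨ triplePosition-core σ e m i i<3 ⟩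
    (m , σ xor tripleSign e , i , latinColumn i e)
      ≡⟨ cong₂ (λ q k → m , q , i , k) (xor-cancelʳ (tripleSign e) p) (latinColumn-latin i j i<3 j<3) ⟩
    (m , p , i , j)                              ∎
    where
    e = latin i j
    σ = tripleSign e xor p

  2*P≡ : 2 * P ≡ 6 + 4 * s
  2*P≡ = identity s
    where identity : ∀ s → 2 * (3 + 2 * s) ≡ 6 + 4 * s
          identity = solve-∀

  P*2≡ : P * 2 ≡ 6 + 4 * s
  P*2≡ = trans (ℕₚ.*-comm P 2) 2*P≡

  pairOffset-<n : ∀ p u → u < P → 5 + (bit p * P + u) < n
  pairOffset-<n p u u<P = ℕₚ.+-monoʳ-< 5 (subst (bit p * P + u <_) 2*P≡ (*+-<′ P (s≤s (bit≤1 p)) u<P))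

  locate-pairCell : ∀ m p i u σ → m < c → i < 3 → u < P →
                    locate (pairCell m p i (u , σ)) ≡ (m , p , i , 3 + (2 * u + bit σ))
  locate-pairCell m p i u σ m<c i<3 u<P = begin
    locate (σ′ , tripleCode (m * n + (5 + o)) i) ≡⟨ locate-triple σ′ i m (5 + o) i<3 m<c (pairOffset-<n p u u<P) ⟩
    (m , fromBit (o / P) , i , 3 + (2 * (o % P) + bit (σ′ xor tripleSign i)))
      ≡⟨ cong₂ (λ q v → m , fromBit q , i , 3 + (2 * v + bit (σ′ xor tripleSign i)))
               (proj₁ unique) (proj₂ unique) ⟩
    (m , fromBit (bit p) , i , 3 + (2 * u + bit (σ′ xor tripleSign i)))
      ≡⟨ cong₂ (λ q τ → m , q , i , 3 + (2 * u + bit τ)) (fromBit-bit p) (xor-cancelʳ (tripleSign i) σ) ⟩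
    (m , p , i , 3 + (2 * u + bit σ)) ∎
    where
    σ′ = tripleSign i xor σ
    o = bit p * P + u
    unique = /-%-unique P (bit p) u u<P

  locate-upperCell : ∀ m p i j → m < c → i < 3 → j < b → locate (upperCell m p i j) ≡ (m , p , i , j)
  locate-upperCell m p i 0 m<c i<3 _ = locate-coreCell m p i 0 m<c i<3 (s≤s z≤n)
  locate-upperCell m p i 1 m<c i<3 _ = locate-coreCell m p i 1 m<c i<3 (s≤s (s≤s z≤n))
  locate-upperCell m p i 2 m<c i<3 _ = locate-coreCell m p i 2 m<c i<3 (s≤s (s≤s (s≤s z≤n)))
  locate-upperCell m p i (suc (suc (suc j))) m<c i<3 (s≤s (s≤s (s≤s j<))) =
    trans (locate-pairCell m p i (proj₁ (halve j)) (proj₂ (halve j)) m<c i<3 u<P)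
          (cong (λ k → m , p , i , 3 + k) (halve-correct j))
    where u<P = halve-< j P (subst (j <_) (sym 2*P≡) j<)

  sideOffset-< : ∀ p e → sideOffset p e < 4
  sideOffset-< false 1             = s≤s (s≤s z≤n)
  sideOffset-< false 0             = ℕₚ.≤-refl
  sideOffset-< false (suc (suc _)) = ℕₚ.≤-refl
  sideOffset-< true  1             = ℕₚ.≤-refl
  sideOffset-< true  0             = s≤s (s≤s z≤n)
  sideOffset-< true  (suc (suc _)) = s≤s (s≤s z≤n)

  sideOffset-<n : ∀ p e → sideOffset p e < n
  sideOffset-<n p e = <11⇒<n (ℕₚ.≤-trans (sideOffset-< p e) (ℕₚ.+-monoʳ-≤ 4 z≤n))

  triplePosition-side : ∀ σ e m p → e < 3 →
    triplePosition σ e m (sideOffset p e) ≡ (m , p , lowerRow (not (σ xor tripleSign e)) , sideColumn e)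
  triplePosition-side σ 0 m false _ = refl
  triplePosition-side σ 1 m false _ = refl
  triplePosition-side σ 2 m false _ = refl
  triplePosition-side σ 0 m true  _ = refl
  triplePosition-side σ 1 m true  _ = refl
  triplePosition-side σ 2 m true  _ = refl
  triplePosition-side σ (suc (suc (suc _))) m p (s≤s (s≤s (s≤s ())))

  unflip-side : ∀ t r → not ((not t xor r) xor t) ≡ r
  unflip-side true  true  = refl
  unflip-side true  false = refl
  unflip-side false true  = refl
  unflip-side false false = refl

  locate-side : ∀ m p r e → m < c → e < 3 →
    locate (not (tripleSign e) xor r , tripleCode (m * n + sideOffset p e) e) ≡ (m , p , lowerRow r , sideColumn e)
  locate-side m p r e m<c e<3 = begin
    locate (σ , tripleCode (m * n + sideOffset p e) e)
      ≡⟨ locate-triple σ e m (sideOffset p e) e<3 m<c (sideOffset-<n p e) ⟩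
    triplePosition σ e m (sideOffset p e)
      ≡⟨ triplePosition-side σ e m p e<3 ⟩
    (m , p , lowerRow (not (σ xor tripleSign e)) , sideColumn e)
      ≡⟨ cong (λ r′ → m , p , lowerRow r′ , sideColumn e) (unflip-side (tripleSign e) r) ⟩
    (m , p , lowerRow r , sideColumn e) ∎
    where σ = not (tripleSign e) xor r

  locate-wCell₁ : ∀ m p r → locate (lowerCell m p r 1) ≡ (m , p , lowerRow r , 1)
  locate-wCell₁ m p r = trans (cong (λ mr → wPosition (r xor p) mr 0) (halve-2*+ m r))
                              (cong (λ q → m , q , lowerRow r , 1) (xor-cancelʳ r p))

  locate-wCell₂ : ∀ m p r → locate (lowerCell m p r 2) ≡ (m , p , lowerRow r , 2)
  locate-wCell₂ m p r = trans (cong (λ mr → wPosition (not r xor p) mr 1) (halve-2*+ m r))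
                              (cong (λ q → m , q , lowerRow r , 2) (xor-cancelʳ (not r) p))

  quarter-4*+-cong : ∀ {A : Set} (f : ℕ → ℕ → A) q k → k < 4 →
                     f (proj₁ (quarter (4 * q + k))) (proj₂ (quarter (4 * q + k))) ≡ f q k
  quarter-4*+-cong f q k k<4 = cong (λ qk → f (proj₁ qk) (proj₂ qk)) (quarter-4*+ q k k<4)

  locate-quadCode₂ : ∀ σ x ρ k → splitAt nE ρ ≡ x → k < 4 →
                     locate (σ , quadCode₂ x k) ≡ quadPosition σ (nW + ρ) k
  locate-quadCode₂ σ (inj₁ ρ′) ρ k eq k<4 =
    trans (quarter-4*+-cong (λ q → quadPosition σ (nW + q)) ρ′ k k<4)
          (cong (λ q → quadPosition σ (nW + q) k) (sym (proj₁ (splitAt-inj₁ nE ρ eq))))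
  locate-quadCode₂ σ (inj₂ ρ′) ρ k eq k<4 =
    trans (quarter-4*+-cong (λ q → quadPosition σ (nW + (nE + q))) ρ′ k k<4)
          (cong (λ q → quadPosition σ (nW + q) k) (sym (splitAt-inj₂ nE ρ eq)))

  locate-quadCode₁ : ∀ σ x ρ k → splitAt nW ρ ≡ x → k < 4 →
                     locate (σ , quadCode₁ x k) ≡ quadPosition σ ρ k
  locate-quadCode₁ σ (inj₁ ρ′) ρ k eq k<4 =
    trans (quarter-4*+-cong (quadPosition σ) ρ′ k k<4)
          (cong (λ q → quadPosition σ q k) (sym (proj₁ (splitAt-inj₁ nW ρ eq))))
  locate-quadCode₁ σ (inj₂ ρ′) ρ k eq k<4 =
    trans (locate-quadCode₂ σ (splitAt nE ρ′) ρ′ k refl k<4)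
          (cong (λ q → quadPosition σ q k) (sym (splitAt-inj₂ nW ρ eq)))

  locate-quadCode : ∀ σ ρ k → k < 4 → locate (σ , quadCode ρ k) ≡ quadPosition σ ρ k
  locate-quadCode σ ρ k = locate-quadCode₁ σ (splitAt nW ρ) ρ k refl

  unflip-quad : ∀ r t → not ((not r xor t) xor t) ≡ r
  unflip-quad true  true  = refl
  unflip-quad true  false = refl
  unflip-quad false true  = refl
  unflip-quad false false = refl

  4*Q≡ : 4 * Q ≡ 4 + 4 * s
  4*Q≡ = ℕₚ.*-suc 4 s

  Q*4≡ : Q * 4 ≡ 4 + 4 * s
  Q*4≡ = trans (ℕₚ.*-comm Q 4) 4*Q≡

  locate-quadCell : ∀ m p r j → j < 4 + 4 * s → locate (quadCell m p r (quarter j)) ≡ (m , p , lowerRow r , 5 + j)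
  locate-quadCell m p r j j< = begin
    locate (σ , quadCode ρ k) ≡⟨ locate-quadCode σ ρ k (quarter-rem< j) ⟩
    quadPosition σ ρ k
      ≡⟨ cong₂ (λ a v → proj₁ (halve a) , proj₂ (halve a) , lowerRow (not (σ xor quadSign k)) , 5 + (4 * v + k))
               (proj₁ unique) (proj₂ unique) ⟩
    (proj₁ (halve a) , proj₂ (halve a) , lowerRow (not (σ xor quadSign k)) , 5 + (4 * u + k))
      ≡⟨ cong₂ (λ mp r′ → proj₁ mp , proj₂ mp , lowerRow r′ , 5 + (4 * u + k))
               (halve-2*+ m p) (unflip-quad r (quadSign k)) ⟩
    (m , p , lowerRow r , 5 + (4 * u + k)) ≡⟨ cong (λ v → m , p , lowerRow r , 5 + v) (quarter-correct j) ⟩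
    (m , p , lowerRow r , 5 + j) ∎
    where
    u = proj₁ (quarter j)
    k = proj₂ (quarter j)
    a = 2 * m + bit p
    ρ = a * Q + u
    σ = not r xor quadSign k
    unique = /-%-unique Q a u (quarter-< j Q (subst (j <_) (sym 4*Q≡) j<))

  locate-lowerCell : ∀ m p r j → m < c → j < b → locate (lowerCell m p r j) ≡ (m , p , lowerRow r , j)
  locate-lowerCell m p r 0 m<c _ = locate-side m p r 0 m<c (s≤s z≤n)
  locate-lowerCell m p r 1 m<c _ = locate-wCell₁ m p r
  locate-lowerCell m p r 2 m<c _ = locate-wCell₂ m p r
  locate-lowerCell m p r 3 m<c _ = locate-side m p r 1 m<c (s≤s (s≤s z≤n))
  locate-lowerCell m p r 4 m<c _ = locate-side m p r 2 m<c (s≤s (s≤s (s≤s z≤n)))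
  locate-lowerCell m p r (suc (suc (suc (suc (suc j))))) m<c (s≤s (s≤s (s≤s (s≤s (s≤s j<))))) =
    locate-quadCell m p r j j<

  locate-cell : ∀ m p i j → m < c → i < 5 → j < b → locate (cell m p i j) ≡ (m , p , i , j)
  locate-cell m p 0 j m<c _ j<b = locate-upperCell m p 0 j m<c (s≤s z≤n) j<b
  locate-cell m p 1 j m<c _ j<b = locate-upperCell m p 1 j m<c (s≤s (s≤s z≤n)) j<b
  locate-cell m p 2 j m<c _ j<b = locate-upperCell m p 2 j m<c (s≤s (s≤s (s≤s z≤n))) j<b
  locate-cell m p 3 j m<c _ j<b = locate-lowerCell m p true j m<c j<b
  locate-cell m p 4 j m<c _ j<b = locate-lowerCell m p false j m<c j<b
  locate-cell m p (suc (suc (suc (suc (suc _))))) j _ (s≤s (s≤s (s≤s (s≤s (s≤s ()))))) _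

  -- Validity of the codes in use

  tripleCode-valid : ∀ τ e → τ < T → Valid (tripleCode τ e)
  tripleCode-valid τ 0             τ<T = τ<T
  tripleCode-valid τ 1             τ<T = ∸-suc-< T τ τ<T
  tripleCode-valid τ (suc (suc _)) τ<T = τ<T

  quadCode₂-valid : ∀ x ρ k → splitAt nE ρ ≡ x → ρ < nE + nL → k < 4 → Valid (quadCode₂ x k)
  quadCode₂-valid (inj₁ ρ′) ρ k eq _ k<4 =
    *+-< 4 (subst (_< nE) (proj₁ (splitAt-inj₁ nE ρ eq)) (proj₂ (splitAt-inj₁ nE ρ eq))) k<4
  quadCode₂-valid (inj₂ ρ′) ρ k eq ρ< k<4 =
    *+-< 4 (ℕₚ.+-cancelˡ-< nE ρ′ nL (subst (_< nE + nL) (splitAt-inj₂ nE ρ eq) ρ<)) k<4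

  quadCode₁-valid : ∀ x ρ k → splitAt nW ρ ≡ x → ρ < nW + (nE + nL) → k < 4 → Valid (quadCode₁ x k)
  quadCode₁-valid (inj₁ ρ′) ρ k eq _ k<4 =
    subst (4 * ρ′ + k <_) W-quadruples
      (*+-< 4 (subst (_< nW) (proj₁ (splitAt-inj₁ nW ρ eq)) (proj₂ (splitAt-inj₁ nW ρ eq))) k<4) ,
    s≤s (s≤s (s≤s z≤n))
  quadCode₁-valid (inj₂ ρ′) ρ k eq ρ< k<4 = quadCode₂-valid (splitAt nE ρ′) ρ′ k refl
    (ℕₚ.+-cancelˡ-< nW ρ′ (nE + nL) (subst (_< nW + (nE + nL)) (splitAt-inj₂ nW ρ eq) ρ<)) k<4

  quadCode-valid : ∀ ρ k → ρ < 2 * c * Q → k < 4 → Valid (quadCode ρ k)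
  quadCode-valid ρ k ρ< = quadCode₁-valid (splitAt nW ρ) ρ k refl (subst (ρ <_) (sym quadruples-split) ρ<)

  2m+bit-< : ∀ m σ → m < c → 2 * m + bit σ < 2 * c
  2m+bit-< m σ m<c = *+-< 2 m<c (s≤s (bit≤1 σ))

  upperCell-valid : ∀ m p i j → m < c → i < 3 → j < b → Valid (proj₂ (upperCell m p i j))
  upperCell-valid m p i 0 m<c i<3 _ = tripleCode-valid _ (latin i 0) (triple-< m<c (2*i<n i<3))
  upperCell-valid m p i 1 m<c i<3 _ = tripleCode-valid _ (latin i 1) (triple-< m<c (2*i<n i<3))
  upperCell-valid m p i 2 m<c i<3 _ = tripleCode-valid _ (latin i 2) (triple-< m<c (2*i<n i<3))
  upperCell-valid m p i (suc (suc (suc j))) m<c i<3 (s≤s (s≤s (s≤s j<))) =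
    tripleCode-valid _ i (triple-< m<c (pairOffset-<n p _ (halve-< j P (subst (j <_) (sym 2*P≡) j<))))

  lowerCell-valid : ∀ m p r j → m < c → j < b → Valid (proj₂ (lowerCell m p r j))
  lowerCell-valid m p r 0 m<c _ = tripleCode-valid _ 0 (triple-< m<c (sideOffset-<n p 0))
  lowerCell-valid m p r 1 m<c _ = 2m+bit-< m r m<c , s≤s z≤n
  lowerCell-valid m p r 2 m<c _ = 2m+bit-< m r m<c , s≤s (s≤s z≤n)
  lowerCell-valid m p r 3 m<c _ = tripleCode-valid _ 1 (triple-< m<c (sideOffset-<n p 1))
  lowerCell-valid m p r 4 m<c _ = tripleCode-valid _ 2 (triple-< m<c (sideOffset-<n p 2))
  lowerCell-valid m p r (suc (suc (suc (suc (suc j))))) m<c (s≤s (s≤s (s≤s (s≤s (s≤s j<))))) =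
    quadCode-valid _ (proj₂ (quarter j))
      (*+-<′ Q (2m+bit-< m p m<c) (quarter-< j Q (subst (j <_) (sym 4*Q≡) j<)))
      (quarter-rem< j)

  cell-valid : ∀ m p i j → m < c → i < 5 → j < b → Valid (proj₂ (cell m p i j))
  cell-valid m p 0 j m<c _ j<b = upperCell-valid m p 0 j m<c (s≤s z≤n) j<b
  cell-valid m p 1 j m<c _ j<b = upperCell-valid m p 1 j m<c (s≤s (s≤s z≤n)) j<b
  cell-valid m p 2 j m<c _ j<b = upperCell-valid m p 2 j m<c (s≤s (s≤s (s≤s z≤n))) j<b
  cell-valid m p 3 j m<c _ j<b = lowerCell-valid m p true j m<c j<b
  cell-valid m p 4 j m<c _ j<b = lowerCell-valid m p false j m<c j<b
  cell-valid m p (suc (suc (suc (suc (suc _))))) j _ (s≤s (s≤s (s≤s (s≤s (s≤s ()))))) _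

  -- Line sums

  value-not-cancel : ∀ σ k → value (σ , k) ℤ.+ (value (not σ , k) ℤ.+ + 0) ≡ + 0
  value-not-cancel σ k = trans (cong (λ z → value (σ , k) ℤ.+ z) (ℤₚ.+-identityʳ _)) (opposite σ)
    where
    opposite : ∀ σ → value (σ , k) ℤ.+ value (not σ , k) ≡ + 0
    opposite true  = ℤₚ.+-inverseʳ (+ suc (rank k))
    opposite false = ℤₚ.+-inverseˡ (+ suc (rank k))

  value-xor-cancel : ∀ σ k → value (σ xor false , k) ℤ.+ value (σ xor true , k) ≡ + 0
  value-xor-cancel true  k = ℤₚ.+-inverseʳ (+ suc (rank k))
  value-xor-cancel false k = ℤₚ.+-inverseˡ (+ suc (rank k))

  core-< : ∀ {m i} → m < c → i < 3 → m * n + 2 * i < T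
  core-< m<c i<3 = triple-< m<c (2*i<n i<3)

  valueAt : ℕ → Bool → ℕ → ℕ → ℤ
  valueAt m p i j = value (cell m p i j)

  upperValue : ℕ → Bool → ℕ → ℕ → ℤ
  upperValue m p i j = value (upperCell m p i j)

  upperCore-zero : ∀ m p i → m < c → i < 3 → sumℤ 3 (upperValue m p i) ≡ + 0
  upperCore-zero m false 0 m<c i<3 =
    sumℤ-balanced 3 (upperValue m false 0) (triple-balance T _ (core-< m<c i<3))
  upperCore-zero m true  0 m<c i<3 =
    sumℤ-balanced 3 (upperValue m true 0) (sym (triple-balance T _ (core-< m<c i<3)))
  upperCore-zero m false 1 m<c i<3 =
    sumℤ-balanced 3 (upperValue m false 1) (triple-balance T _ (core-< m<c i<3))
  upperCore-zero m true  1 m<c i<3 =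
    sumℤ-balanced 3 (upperValue m true 1) (sym (triple-balance T _ (core-< m<c i<3)))
  upperCore-zero m false 2 m<c i<3 =
    sumℤ-balanced 3 (upperValue m false 2) (triple-balance′ T _ (core-< m<c i<3))
  upperCore-zero m true  2 m<c i<3 =
    sumℤ-balanced 3 (upperValue m true 2) (sym (triple-balance′ T _ (core-< m<c i<3)))
  upperCore-zero m p (suc (suc (suc _))) _ (s≤s (s≤s (s≤s ())))

  upperPairs-zero : ∀ m p i → sumℤ (6 + 4 * s) (λ j → value (pairCell m p i (halve j))) ≡ + 0
  upperPairs-zero m p i = subst (λ l → sumℤ l (λ j → value (pairCell m p i (halve j))) ≡ + 0) P*2≡
    (sumℤ-pairs P (λ uσ → value (pairCell m p i uσ)) (λ u → value-xor-cancel (tripleSign i) _))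

  upperRow-zero : ∀ m p i → m < c → i < 3 → sumℤ b (upperValue m p i) ≡ + 0
  upperRow-zero m p i m<c i<3 = trans (sumℤ-+ 3 (6 + 4 * s) (upperValue m p i))
    (cong₂ ℤ._+_ (upperCore-zero m p i m<c i<3) (upperPairs-zero m p i))

  lowerValue : ℕ → Bool → Bool → ℕ → ℤ
  lowerValue m p r j = value (lowerCell m p r j)

  small-< : ∀ {m k} → m < c → k < 11 → m * n + k < T
  small-< m<c k<11 = triple-< m<c (<11⇒<n k<11)

  lowerLeft-zero : ∀ m p r → m < c → sumℤ 5 (lowerValue m p r) ≡ + 0
  lowerLeft-zero m false true  m<c = sumℤ-balanced 5 (lowerValue m false true)
    (lowerLeft-balance T (m * n) (2 * m + 1) (small-< m<c (s≤s (s≤s z≤n))))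
  lowerLeft-zero m false false m<c = sumℤ-balanced 5 (lowerValue m false false)
    (sym (lowerLeft-balance T (m * n) (2 * m + 0) (small-< m<c (s≤s (s≤s z≤n)))))
  lowerLeft-zero m true  true  m<c = sumℤ-balanced 5 (lowerValue m true true)
    (lowerLeft-balance′ T (m * n) (2 * m + 1) (small-< m<c (s≤s (s≤s (s≤s (s≤s z≤n))))))
  lowerLeft-zero m true  false m<c = sumℤ-balanced 5 (lowerValue m true false)
    (sym (lowerLeft-balance′ T (m * n) (2 * m + 0) (small-< m<c (s≤s (s≤s (s≤s (s≤s z≤n)))))))

  W-rank : ∀ ρ k → rank (W (4 * ρ + k) 2) ≡ (24 * ρ + 5) + 6 * k
  W-rank ρ k = identity ρ k
    where identity : ∀ ρ k → suc (2 * (3 * (4 * ρ + k) + 2)) ≡ (24 * ρ + 5) + 6 * k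
          identity = solve-∀

  E-rank : ∀ ρ k → rank (E (4 * ρ + k)) ≡ suc (2 * (6 * c + 4 * ρ)) + 2 * k
  E-rank ρ k = identity c ρ k
    where identity : ∀ c ρ k → suc (2 * (6 * c + (4 * ρ + k))) ≡ suc (2 * (6 * c + 4 * ρ)) + 2 * k
          identity = solve-∀

  L-rank : ∀ ρ k → rank (L (4 * ρ + k)) ≡ (2 * T + (T + (T + 4 * ρ))) + 1 * k
  L-rank ρ k = identity T ρ k
    where identity : ∀ t ρ k → 2 * t + (t + (t + (4 * ρ + k))) ≡ (2 * t + (t + (t + 4 * ρ))) + 1 * k
          identity = solve-∀

  quadCode₂-progression : ∀ x → Progression (rank ∘ quadCode₂ x)
  quadCode₂-progression (inj₁ ρ) = suc (2 * (6 * c + 4 * ρ)) , 2 , E-rank ρ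
  quadCode₂-progression (inj₂ ρ) = 2 * T + (T + (T + 4 * ρ)) , 1 , L-rank ρ

  quadCode₁-progression : ∀ x → Progression (rank ∘ quadCode₁ x)
  quadCode₁-progression (inj₁ ρ) = 24 * ρ + 5 , 6 , W-rank ρ
  quadCode₁-progression (inj₂ ρ) = quadCode₂-progression (splitAt nE ρ)

  quadruple-balance : ∀ ρ → suc (rank (quadCode ρ 0)) + (suc (rank (quadCode ρ 3)) + 0)
                            ≡ suc (rank (quadCode ρ 1)) + (suc (rank (quadCode ρ 2)) + 0)
  quadruple-balance ρ = progression-balance (rank ∘ quadCode ρ) (quadCode₁-progression (splitAt nW ρ))

  quadruple-zero : ∀ m p r u → sumℤ 4 (λ k → value (quadCell m p r (u , k))) ≡ + 0
  quadruple-zero m p true  u = sumℤ-balanced 4 (λ k → value (quadCell m p true (u , k)))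
    (quadruple-balance ((2 * m + bit p) * Q + u))
  quadruple-zero m p false u = sumℤ-balanced 4 (λ k → value (quadCell m p false (u , k)))
    (sym (quadruple-balance ((2 * m + bit p) * Q + u)))

  lowerQuadruples-zero : ∀ m p r → sumℤ (4 + 4 * s) (λ j → value (quadCell m p r (quarter j))) ≡ + 0
  lowerQuadruples-zero m p r = subst (λ l → sumℤ l (λ j → value (quadCell m p r (quarter j))) ≡ + 0) Q*4≡
    (sumℤ-quadruples Q (λ uk → value (quadCell m p r uk)) (quadruple-zero m p r))

  lowerRow-zero : ∀ m p r → m < c → sumℤ b (lowerValue m p r) ≡ + 0
  lowerRow-zero m p r m<c = trans (sumℤ-+ 5 (4 + 4 * s) (lowerValue m p r))
    (cong₂ ℤ._+_ (lowerLeft-zero m p r m<c) (lowerQuadruples-zero m p r))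

  row-zero : ∀ m p i → m < c → i < 5 → sumℤ b (valueAt m p i) ≡ + 0
  row-zero m p 0 m<c _ = upperRow-zero m p 0 m<c (s≤s z≤n)
  row-zero m p 1 m<c _ = upperRow-zero m p 1 m<c (s≤s (s≤s z≤n))
  row-zero m p 2 m<c _ = upperRow-zero m p 2 m<c (s≤s (s≤s (s≤s z≤n)))
  row-zero m p 3 m<c _ = lowerRow-zero m p true m<c
  row-zero m p 4 m<c _ = lowerRow-zero m p false m<c
  row-zero m p (suc (suc (suc (suc (suc _))))) _ (s≤s (s≤s (s≤s (s≤s (s≤s ())))))

  coreColumn-zero : ∀ m p j → m < c → j < 3 → sumℤ 5 (λ i → valueAt m p i j) ≡ + 0
  coreColumn-zero m false 0 m<c _ = sumℤ-balanced 5 (λ i → valueAt m false i 0)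
    (coreColumn₀-balance T (m * n) (xMag (m * n + 3)) (small-< m<c (s≤s (s≤s (s≤s (s≤s (s≤s z≤n)))))))
  coreColumn-zero m true  0 m<c _ = sumℤ-balanced 5 (λ i → valueAt m true i 0)
    (sym (coreColumn₀-balance T (m * n) (xMag (m * n + 1)) (small-< m<c (s≤s (s≤s (s≤s (s≤s (s≤s z≤n))))))))
  coreColumn-zero m false 1 m<c _ = sumℤ-balanced 5 (λ i → valueAt m false i 1)
    (coreColumn₁-balance T (m * n) (2 * m) (small-< m<c (s≤s (s≤s (s≤s z≤n)))))
  coreColumn-zero m true  1 m<c _ = sumℤ-balanced 5 (λ i → valueAt m true i 1)
    (sym (coreColumn₁-balance T (m * n) (2 * m) (small-< m<c (s≤s (s≤s (s≤s z≤n))))))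
  coreColumn-zero m false 2 m<c _ = sumℤ-balanced 5 (λ i → valueAt m false i 2)
    (coreColumn₂-balance T (m * n) (2 * m) (small-< m<c (s≤s z≤n)))
  coreColumn-zero m true  2 m<c _ = sumℤ-balanced 5 (λ i → valueAt m true i 2)
    (sym (coreColumn₂-balance T (m * n) (2 * m) (small-< m<c (s≤s z≤n))))
  coreColumn-zero m p (suc (suc (suc _))) _ (s≤s (s≤s (s≤s ())))

  pairColumn-zero : ∀ m p u σ → m < c → u < P → sumℤ 3 (λ i → value (pairCell m p i (u , σ))) ≡ + 0
  pairColumn-zero m p u false m<c u<P = sumℤ-balanced 3 (λ i → value (pairCell m p i (u , false)))
    (triple-balance T _ (triple-< m<c (pairOffset-<n p u u<P)))
  pairColumn-zero m p u true  m<c u<P = sumℤ-balanced 3 (λ i → value (pairCell m p i (u , true)))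
    (sym (triple-balance T _ (triple-< m<c (pairOffset-<n p u u<P))))

  lowerPair-cancel : ∀ m p j → sumℤ 2 (λ r → valueAt m p (3 + r) (3 + j)) ≡ + 0
  lowerPair-cancel m p 0             = value-not-cancel true (tripleCode (m * n + sideOffset p 1) 1)
  lowerPair-cancel m p 1             = value-not-cancel false (tripleCode (m * n + sideOffset p 2) 2)
  lowerPair-cancel m p (suc (suc j)) = value-not-cancel (quadSign k) (quadCode ((2 * m + bit p) * Q + u) k)
    where u = proj₁ (quarter j)
          k = proj₂ (quarter j)

  column-zero : ∀ m p j → m < c → j < b → sumℤ 5 (λ i → valueAt m p i j) ≡ + 0
  column-zero m p 0 m<c _ = coreColumn-zero m p 0 m<c (s≤s z≤n)
  column-zero m p 1 m<c _ = coreColumn-zero m p 1 m<c (s≤s (s≤s z≤n))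
  column-zero m p 2 m<c _ = coreColumn-zero m p 2 m<c (s≤s (s≤s (s≤s z≤n)))
  column-zero m p (suc (suc (suc j))) m<c (s≤s (s≤s (s≤s j<))) =
    trans (sumℤ-+ 3 2 (λ i → valueAt m p i (3 + j)))
          (cong₂ ℤ._+_ (pairColumn-zero m p (proj₁ (halve j)) (proj₂ (halve j)) m<c u<P) (lowerPair-cancel m p j))
    where u<P = halve-< j P (subst (j <_) (sym 2*P≡) j<)

  value-within : ∀ σ k → Valid k → NonzeroWithin M (value (σ , k))
  value-within true  k valid = (λ ()) , rank-< k valid
  value-within false k valid = (λ ()) , rank-< k valid

  value-injective : ∀ σ σ′ k k′ → value (σ , k) ≡ value (σ′ , k′) → σ ≡ σ′ × rank k ≡ rank k′
  value-injective true  true  k k′ eq = refl , cong (ℕ.pred ∘ ∣_∣) eq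
  value-injective false false k k′ eq = refl , cong (ℕ.pred ∘ ∣_∣) eq
  value-injective true  false k k′ ()
  value-injective false true  k k′ ()

  cell-injective : ∀ m p i j m′ p′ i′ j′ → m < c → i < 5 → j < b → m′ < c → i′ < 5 → j′ < b →
                   valueAt m p i j ≡ valueAt m′ p′ i′ j′ → (m , p , i , j) ≡ (m′ , p′ , i′ , j′)
  cell-injective m p i j m′ p′ i′ j′ m<c i<5 j<b m′<c i′<5 j′<b eq = begin
    (m , p , i , j)         ≡⟨ sym (locate-cell m p i j m<c i<5 j<b) ⟩
    locate (cell m p i j)   ≡⟨ cong locate same-cell ⟩
    locate (cell m′ p′ i′ j′) ≡⟨ locate-cell m′ p′ i′ j′ m′<c i′<5 j′<b ⟩
    (m′ , p′ , i′ , j′)     ∎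
    where
    same = value-injective _ _ _ _ eq
    same-cell : cell m p i j ≡ cell m′ p′ i′ j′
    same-cell = cong₂ _,_ (proj₁ same) (rank-injective _ _ (cell-valid m p i j m<c i<5 j<b)
                                                          (cell-valid m′ p′ i′ j′ m′<c i′<5 j′<b) (proj₂ same))

  pairIndex : Fin (2 * c) → ℕ
  pairIndex k = proj₁ (halve (toℕ k))

  parity : Fin (2 * c) → Bool
  parity k = proj₂ (halve (toℕ k))

  pairIndex-< : ∀ k → pairIndex k < c
  pairIndex-< k = halve-< (toℕ k) c (Finₚ.toℕ<n k)

  arrays : Arrays 5 b (2 * c)
  arrays k i j = valueAt (pairIndex k) (parity k) (toℕ i) (toℕ j)

  arrays-within : ∀ k i j → NonzeroWithin M (arrays k i j)
  arrays-within k i j = value-within _ _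
    (cell-valid (pairIndex k) (parity k) (toℕ i) (toℕ j) (pairIndex-< k) (Finₚ.toℕ<n i) (Finₚ.toℕ<n j))

  arrays-injective : ∀ k i j k′ i′ j′ → arrays k i j ≡ arrays k′ i′ j′ →
                     (k ≡ k′) × (i ≡ i′) × (j ≡ j′)
  arrays-injective k i j k′ i′ j′ eq =
    Finₚ.toℕ-injective (begin
      toℕ k                            ≡⟨ sym (halve-correct (toℕ k)) ⟩
      2 * pairIndex k + bit (parity k)
        ≡⟨ cong₂ (λ m p → 2 * m + bit p) (cong proj₁ same) (cong (proj₁ ∘ proj₂) same) ⟩
      2 * pairIndex k′ + bit (parity k′) ≡⟨ halve-correct (toℕ k′) ⟩
      toℕ k′                           ∎) ,
    Finₚ.toℕ-injective (cong (proj₁ ∘ proj₂ ∘ proj₂) same) ,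
    Finₚ.toℕ-injective (cong (proj₂ ∘ proj₂ ∘ proj₂) same)
    where
    same = cell-injective (pairIndex k) (parity k) (toℕ i) (toℕ j) (pairIndex k′) (parity k′) (toℕ i′) (toℕ j′)
      (pairIndex-< k) (Finₚ.toℕ<n i) (Finₚ.toℕ<n j) (pairIndex-< k′) (Finₚ.toℕ<n i′) (Finₚ.toℕ<n j′) eq

  arrays-rows : ∀ k i → sumFin b (λ j → arrays k i j) ≡ + 0
  arrays-rows k i = trans (sumFin-toℕ b (valueAt (pairIndex k) (parity k) (toℕ i)))
                          (row-zero (pairIndex k) (parity k) (toℕ i) (pairIndex-< k) (Finₚ.toℕ<n i))

  arrays-columns : ∀ k j → sumFin 5 (λ i → arrays k i j) ≡ + 0
  arrays-columns k j = trans (sumFin-toℕ 5 (λ i → valueAt (pairIndex k) (parity k) i (toℕ j)))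
                             (column-zero (pairIndex k) (parity k) (toℕ j) (pairIndex-< k) (Finₚ.toℕ<n j))

  smas : SMAS 5 b (2 * c)
  smas = injective-within⇒SMAS 5 b (2 * c) M (identity b c)
           arrays arrays-within arrays-injective arrays-rows arrays-columns
    where identity : ∀ b c → 5 * b * (2 * c) ≡ 5 * b * c * 2
          identity = solve-∀

≡1-mod-4 : ∀ b → 9 ≤ b → b % 4 ≡ 1 → ∃ λ s → b ≡ 9 + 4 * s
≡1-mod-4 b 9≤b b%4≡1 = from-quotient (b / 4) (trans (m≡m%n+[m/n]*n b 4) (cong (_+ b / 4 * 4) b%4≡1))
  where
  from-quotient : ∀ q → b ≡ 1 + q * 4 → ∃ λ s → b ≡ 9 + 4 * s
  from-quotient 0 eq with subst (9 ≤_) eq 9≤b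
  ... | s≤s ()
  from-quotient 1 eq with subst (9 ≤_) eq 9≤b
  ... | s≤s (s≤s (s≤s (s≤s (s≤s ()))))
  from-quotient (suc (suc s)) eq = s , trans eq (identity s)
    where identity : ∀ s → 1 + suc (suc s) * 4 ≡ 9 + 4 * s
          identity = solve-∀

≡0-mod-4 : ∀ c → 4 ≤ c → c % 4 ≡ 0 → ∃ λ g → c ≡ 4 * suc g
≡0-mod-4 c 4≤c c%4≡0 = from-quotient (c / 4) (trans (m≡m%n+[m/n]*n c 4) (cong (_+ c / 4 * 4) c%4≡0))
  where
  from-quotient : ∀ q → c ≡ 0 + q * 4 → ∃ λ g → c ≡ 4 * suc g
  from-quotient 0 eq with subst (4 ≤_) eq 4≤c
  ... | ()
  from-quotient (suc g) eq = g , trans eq (ℕₚ.*-comm (suc g) 4)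

lemma3p1 : (b : ℕ) → 9 ≤ b → b % 4 ≡ 1 →
           (c : ℕ) → 4 ≤ c → c % 4 ≡ 0 →
           SMAS 5 b (2 * c)
lemma3p1 b 9≤b b%4≡1 c 4≤c c%4≡0 with ≡1-mod-4 b 9≤b b%4≡1 | ≡0-mod-4 c 4≤c c%4≡0
... | s , refl | g , refl = Construction.smas s g
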